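{- Every (non-EQR) NLA-freshness context $\nabla$ can be transformed into an equivalent EQR-freshness context: there is an EQR-freshness context $\mathcal{C}$ over the set $M$ of atom-variables occurring in $\nabla$ such that for every interpretation $\rho$, $\nabla\rho$ holds if and only if $\rho$ satisfies $\mathcal{C}$.
   Context: NLA-terms over term-variables $X$ and atom-variables $A$ (and a signature of function symbols): $s::=W\mid\pi\cdot X\mid f(s_1,\dots,s_n)\mid\lambda W.s$, $W::=\pi\cdot A$, $\pi::=\mathit{id}\mid(W_1\,W_2)\circ\pi$. A freshness context is a finite set of constraints $W\#s$. An interpretation $\rho$ maps atom-variables to atoms (not necessarily injectively) and term-variables to ground terms over atoms, extended homomorphically (swappings become swappings of atoms); $\nabla\rho$ holds iff for every $W\#s\in\nabla$ the atom $W\rho$ does not occur free in $s\rho$. Let $M$ be a finite set of atom-variables. An EQR-freshness constraint is a pair $(S,C)$ where $S$ is a set of equations $A=B$ and disequations $A\neq B$ between atom-variables of $M$, and $C$ is either a set of constraints $A\#X$ with $A\in M$ and $X$ a term-variable, or the symbol False. An EQR-freshness context is a finite set of EQR-freshness constraints; an interpretation $\rho$ satisfies it iff for some pair $(S,C)$ in it, all equations/disequations of $S$ hold for the atoms assigned by $\rho$, $C\neq$ False, and $A\rho$ is not free in $X\rho$ for all $A\#X\in C$. -}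

module Defs where

open import Data.Nat using (ℕ; _≟_)
open import Data.List using (List; []; _∷_; _++_)
open import Data.List.Relation.Unary.All using (All)
open import Data.List.Relation.Unary.Any using (Any)
open import Data.List.Membership.Propositional using (_∈_)
open import Data.Product using (_×_; _,_; proj₁; proj₂)
open import Data.Maybe using (Maybe; just; nothing)
open import Data.Empty using (⊥)
open import Relation.Nullary using (¬_; yes; no)
open import Relation.Binary.PropositionalEquality using (_≡_; _≢_)

-- Atom-variables, term-variables and atoms are all represented by ℕ
-- (the set of atoms is countably infinite).  F is the set of function symbols.
AtomVar : Set
AtomVar = ℕ

TermVar : Set
TermVar = ℕ

Atom : Set
Atom = ℕ

-- W ::= π · A ,   π ::= id | (W1 W2) ∘ π   (π represented as a list of swappings,
-- the head swapping is the outermost one).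
data AExp : Set where
  _·ᵃ_ : List (AExp × AExp) → AtomVar → AExp

Perm : Set
Perm = List (AExp × AExp)

data Term (F : Set) : Set where
  atm : AExp → Term F
  sus : Perm → TermVar → Term F
  fun : F → List (Term F) → Term F
  lam : AExp → Term F → Term F

data GTerm (F : Set) : Set where
  gat  : Atom → GTerm F
  gfun : F → List (GTerm F) → GTerm F
  glam : Atom → GTerm F → GTerm F

swapAtom : Atom → Atom → Atom → Atom
swapAtom a b c with c ≟ a
... | yes _ = b
... | no _ with c ≟ b
... | yes _ = a
... | no _ = c

module _ {F : Set} where
  mutual
    swapG : Atom → Atom → GTerm F → GTerm F
    swapG a b (gat c) = gat (swapAtom a b c)
    swapG a b (gfun f ts) = gfun f (swapGs a b ts)
    swapG a b (glam c t) = glam (swapAtom a b c) (swapG a b t)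

    swapGs : Atom → Atom → List (GTerm F) → List (GTerm F)
    swapGs a b [] = []
    swapGs a b (t ∷ ts) = swapG a b t ∷ swapGs a b ts

  data FreeIn (a : Atom) : GTerm F → Set where
    free-at  : FreeIn a (gat a)
    free-fun : ∀ {f ts} → Any (FreeIn a) ts → FreeIn a (gfun f ts)
    free-lam : ∀ {b t} → a ≢ b → FreeIn a t → FreeIn a (glam b t)

-- interpretations: atom-variables ↦ atoms (not necessarily injective),
-- term-variables ↦ ground terms
record Interp (F : Set) : Set where
  field
    atomOf : AtomVar → Atom
    termOf : TermVar → GTerm F
open Interp public

module _ {F : Set} (ρ : Interp F) where
  mutual
    ⟦_⟧ᵃ : AExp → Atom
    ⟦ π ·ᵃ A ⟧ᵃ = permAtom π (atomOf ρ A)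

    permAtom : Perm → Atom → Atom
    permAtom [] c = c
    permAtom ((w₁ , w₂) ∷ π) c = swapAtom ⟦ w₁ ⟧ᵃ ⟦ w₂ ⟧ᵃ (permAtom π c)

  permG : Perm → GTerm F → GTerm F
  permG [] t = t
  permG ((w₁ , w₂) ∷ π) t = swapG ⟦ w₁ ⟧ᵃ ⟦ w₂ ⟧ᵃ (permG π t)

  mutual
    ⟦_⟧ : Term F → GTerm F
    ⟦ atm w ⟧ = gat ⟦ w ⟧ᵃ
    ⟦ sus π X ⟧ = permG π (termOf ρ X)
    ⟦ fun f ss ⟧ = gfun f ⟦ ss ⟧s
    ⟦ lam w s ⟧ = glam ⟦ w ⟧ᵃ ⟦ s ⟧

    ⟦_⟧s : List (Term F) → List (GTerm F)
    ⟦ [] ⟧s = []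
    ⟦ s ∷ ss ⟧s = ⟦ s ⟧ ∷ ⟦ ss ⟧s

FreshCtx : Set → Set
FreshCtx F = List (AExp × Term F)

HoldsCtx : {F : Set} → Interp F → FreshCtx F → Set
HoldsCtx ρ ∇ = All (λ c → ¬ FreeIn (⟦ ρ ⟧ᵃ (proj₁ c)) (⟦ ρ ⟧ (proj₂ c))) ∇

mutual
  avA : AExp → List AtomVar
  avA (π ·ᵃ A) = A ∷ avP π

  avP : Perm → List AtomVar
  avP [] = []
  avP ((w₁ , w₂) ∷ π) = avA w₁ ++ avA w₂ ++ avP π

module _ {F : Set} where
  mutual
    avT : Term F → List AtomVar
    avT (atm w) = avA w
    avT (sus π X) = avP π
    avT (fun f ss) = avTs ss
    avT (lam w s) = avA w ++ avT s

    avTs : List (Term F) → List AtomVar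
    avTs [] = []
    avTs (s ∷ ss) = avT s ++ avTs ss

atomVarsCtx : {F : Set} → FreshCtx F → List AtomVar
atomVarsCtx [] = []
atomVarsCtx ((w , s) ∷ ∇) = avA w ++ avT s ++ atomVarsCtx ∇

data EqLit : Set where
  _≐_ : AtomVar → AtomVar → EqLit
  _≭_ : AtomVar → AtomVar → EqLit

-- (S , C): C = nothing encodes False, C = just cs a set of constraints A # X
EQRConstraint : Set
EQRConstraint = List EqLit × Maybe (List (AtomVar × TermVar))

EQRCtx : Set
EQRCtx = List EQRConstraint

LitOver : List AtomVar → EqLit → Set
LitOver M (A ≐ B) = A ∈ M × B ∈ M
LitOver M (A ≭ B) = A ∈ M × B ∈ M

COver : List AtomVar → Maybe (List (AtomVar × TermVar)) → Set
COver M nothing = Data.Unit.⊤ where import Data.Unit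
COver M (just cs) = All (λ c → proj₁ c ∈ M) cs

EQROver : List AtomVar → EQRCtx → Set
EQROver M 𝒞 = All (λ sc → All (LitOver M) (proj₁ sc) × COver M (proj₂ sc)) 𝒞

module _ {F : Set} (ρ : Interp F) where
  LitHolds : EqLit → Set
  LitHolds (A ≐ B) = atomOf ρ A ≡ atomOf ρ B
  LitHolds (A ≭ B) = atomOf ρ A ≢ atomOf ρ B

  CHolds : Maybe (List (AtomVar × TermVar)) → Set
  CHolds nothing = ⊥
  CHolds (just cs) = All (λ c → ¬ FreeIn (atomOf ρ (proj₁ c)) (termOf ρ (proj₂ c))) cs

  SatEQR : EQRCtx → Set
  SatEQR 𝒞 = Any (λ sc → All LitHolds (proj₁ sc) × CHolds (proj₂ sc)) 𝒞

{-# OPTIONS --safe #-}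
-- Split on every pattern S of equalities and disequalities between the atom-variables M of ∇.
-- Once S is fixed, every atom expression π·A denotes the same atom as some single variable of M,
-- computed symbolically by letting the swappings act on variables and deciding their equalities
-- by S. A constraint W # s then compiles structurally: W # W′ is False or True as S says, W # λW′.s
-- is True if W = W′ and W # s otherwise, W # f(s₁,…,sₙ) is a conjunction, and W # π·X becomes
-- π⁻¹·W # X, a constraint A # X. The EQR-context has one pair (S, compiled constraints) per S.
module Submission where

open import Defs
open import Data.Product using (∃-syntax; _×_)
open import Function.Bundles using (_⇔_)

open import Data.Bool using (Bool; true; false; if_then_else_)
open import Data.List using (List; []; _∷_; _++_; map; cartesianProduct)
open import Data.List.Membership.Propositional using (_∈_)
open import Data.List.Membership.Propositional.Properties
  using (∈-map⁺; ∈-cartesianProduct⁺; ∈-cartesianProduct⁻)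
open import Data.List.Relation.Unary.All as All using (All; []; _∷_)
import Data.List.Relation.Unary.All.Properties as Allₚ
open import Data.List.Relation.Unary.Any as Any using (Any; here; there)
import Data.List.Relation.Unary.Any.Properties as Anyₚ
open import Data.Maybe as Maybe using (Maybe; just; nothing)
open import Data.Nat using (_≟_)
open import Data.Product using (_,_; proj₁; proj₂; uncurry)
open import Data.Product.Properties using (≡-dec)
open import Data.Product.Function.NonDependent.Propositional using (_×-⇔_)
open import Function using (id; _∘_)
open import Function.Bundles using (mk⇔; Equivalence)
open import Function.Construct.Composition using (_⇔-∘_)
open import Function.Construct.Identity using (⇔-id)
open import Function.Construct.Symmetry using (⇔-sym)
open import Function.Related.TypeIsomorphisms using (¬-cong-⇔)
open import Relation.Nullary using (¬_; Dec; yes; no; contradiction)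
open import Relation.Nullary.Reflects using (Reflects; ofʸ; ofⁿ)
open import Relation.Binary.PropositionalEquality
  using (_≡_; _≢_; refl; sym; trans; cong; cong₂; subst; module ≡-Reasoning)

open Equivalence using (to; from)

All-∷⇔ : ∀ {A : Set} {P : A → Set} {x xs} → All P (x ∷ xs) ⇔ (P x × All P xs)
All-∷⇔ = mk⇔ All.uncons (uncurry _∷_)

swapAtom-≡ˡ : ∀ {a b c} → c ≡ a → swapAtom a b c ≡ b
swapAtom-≡ˡ {a} {b} {c} c≡a with c ≟ a
... | yes _   = refl
... | no c≢a = contradiction c≡a c≢a

swapAtom-≡ʳ : ∀ {a b c} → c ≡ b → swapAtom a b c ≡ a
swapAtom-≡ʳ {a} {b} {c} c≡b with c ≟ a
... | yes c≡a = trans (sym c≡b) c≡a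
... | no _ with c ≟ b
...   | yes _   = refl
...   | no c≢b = contradiction c≡b c≢b

swapAtom-≢ : ∀ {a b c} → c ≢ a → c ≢ b → swapAtom a b c ≡ c
swapAtom-≢ {a} {b} {c} c≢a c≢b with c ≟ a
... | yes c≡a = contradiction c≡a c≢a
... | no _ with c ≟ b
...   | yes c≡b = contradiction c≡b c≢b
...   | no _    = refl

swapAtom-involutive : ∀ a b c → swapAtom a b (swapAtom a b c) ≡ c
swapAtom-involutive a b c = by-cases (c ≟ a) (c ≟ b)
  where
  open ≡-Reasoning
  by-cases : Dec (c ≡ a) → Dec (c ≡ b) → swapAtom a b (swapAtom a b c) ≡ c
  by-cases (yes c≡a) _ = begin
    swapAtom a b (swapAtom a b c) ≡⟨ cong (swapAtom a b) (swapAtom-≡ˡ c≡a) ⟩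
    swapAtom a b b                ≡⟨ swapAtom-≡ʳ {a} {b} refl ⟩
    a                             ≡⟨ sym c≡a ⟩
    c                             ∎
  by-cases (no _) (yes c≡b) = begin
    swapAtom a b (swapAtom a b c) ≡⟨ cong (swapAtom a b) (swapAtom-≡ʳ c≡b) ⟩
    swapAtom a b a                ≡⟨ swapAtom-≡ˡ {a} {b} refl ⟩
    b                             ≡⟨ sym c≡b ⟩
    c                             ∎
  by-cases (no c≢a) (no c≢b) = begin
    swapAtom a b (swapAtom a b c) ≡⟨ cong (swapAtom a b) (swapAtom-≢ c≢a c≢b) ⟩
    swapAtom a b c                ≡⟨ swapAtom-≢ c≢a c≢b ⟩
    c                             ∎

module _ {F : Set} {a b : Atom} where
  mutual
    FreeIn-swapG⁺ : ∀ {c} (t : GTerm F) → FreeIn (swapAtom a b c) t → FreeIn c (swapG a b t)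
    FreeIn-swapG⁺ {c} (gat _) free-at =
      subst (λ d → FreeIn c (gat d)) (sym (swapAtom-involutive a b c)) free-at
    FreeIn-swapG⁺ (gfun f ts) (free-fun p) = free-fun (Any-FreeIn-swapGs⁺ ts p)
    FreeIn-swapG⁺ (glam d t) (free-lam c′≢d p) =
      free-lam (λ c≡d′ → c′≢d (trans (cong (swapAtom a b) c≡d′) (swapAtom-involutive a b d)))
               (FreeIn-swapG⁺ t p)

    Any-FreeIn-swapGs⁺ : ∀ {c} (ts : List (GTerm F)) →
      Any (FreeIn (swapAtom a b c)) ts → Any (FreeIn c) (swapGs a b ts)
    Any-FreeIn-swapGs⁺ (t ∷ ts) (here p)  = here (FreeIn-swapG⁺ t p)
    Any-FreeIn-swapGs⁺ (t ∷ ts) (there p) = there (Any-FreeIn-swapGs⁺ ts p)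

  mutual
    FreeIn-swapG⁻ : ∀ {c} (t : GTerm F) → FreeIn c (swapG a b t) → FreeIn (swapAtom a b c) t
    FreeIn-swapG⁻ (gat d) free-at =
      subst (λ d′ → FreeIn d′ (gat d)) (sym (swapAtom-involutive a b d)) free-at
    FreeIn-swapG⁻ (gfun f ts) (free-fun p) = free-fun (Any-FreeIn-swapGs⁻ ts p)
    FreeIn-swapG⁻ {c} (glam d t) (free-lam c≢d′ p) =
      free-lam (λ c′≡d → c≢d′ (trans (sym (swapAtom-involutive a b c)) (cong (swapAtom a b) c′≡d)))
               (FreeIn-swapG⁻ t p)

    Any-FreeIn-swapGs⁻ : ∀ {c} (ts : List (GTerm F)) →
      Any (FreeIn c) (swapGs a b ts) → Any (FreeIn (swapAtom a b c)) ts
    Any-FreeIn-swapGs⁻ (t ∷ ts) (here p)  = here (FreeIn-swapG⁻ t p)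
    Any-FreeIn-swapGs⁻ (t ∷ ts) (there p) = there (Any-FreeIn-swapGs⁻ ts p)

  FreeIn-swapG : ∀ {c} (t : GTerm F) → FreeIn c (swapG a b t) ⇔ FreeIn (swapAtom a b c) t
  FreeIn-swapG t = mk⇔ (FreeIn-swapG⁻ t) (FreeIn-swapG⁺ t)

unpermAtom : ∀ {F} → Interp F → Perm → Atom → Atom
unpermAtom ρ []              c = c
unpermAtom ρ ((w₁ , w₂) ∷ π) c = unpermAtom ρ π (swapAtom (⟦ ρ ⟧ᵃ w₁) (⟦ ρ ⟧ᵃ w₂) c)

FreeIn-permG : ∀ {F} (ρ : Interp F) π {c} (t : GTerm F) →
  FreeIn c (permG ρ π t) ⇔ FreeIn (unpermAtom ρ π c) t
FreeIn-permG ρ []              t = ⇔-id _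
FreeIn-permG ρ ((w₁ , w₂) ∷ π) t = FreeIn-permG ρ π t ⇔-∘ FreeIn-swapG (permG ρ π t)

module _ {F : Set} {a : Atom} where
  FreeIn-gat : ∀ {b} → FreeIn {F} a (gat b) ⇔ a ≡ b
  FreeIn-gat = mk⇔ (λ { free-at → refl }) (λ { refl → free-at })

  fresh-gfun : ∀ {f} {ts : List (GTerm F)} → (¬ FreeIn a (gfun f ts)) ⇔ All (λ t → ¬ FreeIn a t) ts
  fresh-gfun = mk⇔ (λ fresh → Allₚ.¬Any⇒All¬ _ (fresh ∘ free-fun))
                   (λ { all-fresh (free-fun p) → Allₚ.All¬⇒¬Any all-fresh p })

  FreeIn-glam : ∀ {b} {t : GTerm F} → a ≢ b → FreeIn a (glam b t) ⇔ FreeIn a t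
  FreeIn-glam a≢b = mk⇔ (λ { (free-lam _ p) → p }) (free-lam a≢b)

EqOracle : Set
EqOracle = AtomVar → AtomVar → Bool

Decides : ∀ {F} → Interp F → EqOracle → List AtomVar → Set
Decides ρ e M = ∀ {A B} → A ∈ M → B ∈ M → Reflects (atomOf ρ A ≡ atomOf ρ B) (e A B)

All-avP-∷⁻ : ∀ {P : AtomVar → Set} w₁ w₂ π → All P (avP ((w₁ , w₂) ∷ π)) →
  All P (avA w₁) × All P (avA w₂) × All P (avP π)
All-avP-∷⁻ w₁ w₂ π s with Allₚ.++⁻ (avA w₁) s
... | s₁ , s₂π = s₁ , Allₚ.++⁻ (avA w₂) s₂π

module _ (e : EqOracle) where
  swapVar : AtomVar → AtomVar → AtomVar → AtomVar
  swapVar A B C = if e C A then B else if e C B then A else C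

  mutual
    evalVar : AExp → AtomVar
    evalVar (π ·ᵃ A) = permVar π A

    permVar : Perm → AtomVar → AtomVar
    permVar []              C = C
    permVar ((w₁ , w₂) ∷ π) C = swapVar (evalVar w₁) (evalVar w₂) (permVar π C)

  unpermVar : Perm → AtomVar → AtomVar
  unpermVar []              C = C
  unpermVar ((w₁ , w₂) ∷ π) C = unpermVar π (swapVar (evalVar w₁) (evalVar w₂) C)

  module _ {M : List AtomVar} where
    swapVar-∈ : ∀ {A B C} → A ∈ M → B ∈ M → C ∈ M → swapVar A B C ∈ M
    swapVar-∈ {A} {B} {C} A∈M B∈M C∈M with e C A | e C B
    ... | true  | _     = B∈M
    ... | false | true  = A∈M
    ... | false | false = C∈M

    mutual
      evalVar-∈ : ∀ w → All (_∈ M) (avA w) → evalVar w ∈ M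
      evalVar-∈ (π ·ᵃ A) (A∈M ∷ π⊆M) = permVar-∈ π π⊆M A∈M

      permVar-∈ : ∀ π {C} → All (_∈ M) (avP π) → C ∈ M → permVar π C ∈ M
      permVar-∈ []              _    C∈M = C∈M
      permVar-∈ ((w₁ , w₂) ∷ π) π⊆M C∈M with All-avP-∷⁻ w₁ w₂ π π⊆M
      ... | w₁⊆M , w₂⊆M , π′⊆M =
        swapVar-∈ (evalVar-∈ w₁ w₁⊆M) (evalVar-∈ w₂ w₂⊆M) (permVar-∈ π π′⊆M C∈M)

    unpermVar-∈ : ∀ π {C} → All (_∈ M) (avP π) → C ∈ M → unpermVar π C ∈ M
    unpermVar-∈ []              _    C∈M = C∈M
    unpermVar-∈ ((w₁ , w₂) ∷ π) π⊆M C∈M with All-avP-∷⁻ w₁ w₂ π π⊆M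
    ... | w₁⊆M , w₂⊆M , π′⊆M =
      unpermVar-∈ π π′⊆M (swapVar-∈ (evalVar-∈ w₁ w₁⊆M) (evalVar-∈ w₂ w₂⊆M) C∈M)

module _ {e : EqOracle} {F : Set} {ρ : Interp F} {M : List AtomVar} (dec : Decides ρ e M) where
  swapVar-sound : ∀ {A B C} → A ∈ M → B ∈ M → C ∈ M →
    atomOf ρ (swapVar e A B C) ≡ swapAtom (atomOf ρ A) (atomOf ρ B) (atomOf ρ C)
  swapVar-sound {A} {B} {C} A∈M B∈M C∈M with e C A | dec C∈M A∈M
  ... | true  | ofʸ C≈A = sym (swapAtom-≡ˡ C≈A)
  ... | false | ofⁿ C≉A with e C B | dec C∈M B∈M
  ...   | true  | ofʸ C≈B = sym (swapAtom-≡ʳ C≈B)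
  ...   | false | ofⁿ C≉B = sym (swapAtom-≢ C≉A C≉B)

  mutual
    evalVar-sound : ∀ w → All (_∈ M) (avA w) → atomOf ρ (evalVar e w) ≡ ⟦ ρ ⟧ᵃ w
    evalVar-sound (π ·ᵃ A) (A∈M ∷ π⊆M) = permVar-sound π π⊆M A∈M

    permVar-sound : ∀ π {C} → All (_∈ M) (avP π) → C ∈ M →
      atomOf ρ (permVar e π C) ≡ permAtom ρ π (atomOf ρ C)
    permVar-sound []              _    _   = refl
    permVar-sound ((w₁ , w₂) ∷ π) {C} π⊆M C∈M with All-avP-∷⁻ w₁ w₂ π π⊆M
    ... | w₁⊆M , w₂⊆M , π′⊆M = begin
      atomOf ρ (swapVar e (evalVar e w₁) (evalVar e w₂) (permVar e π C))
        ≡⟨ swapVar-sound (evalVar-∈ e w₁ w₁⊆M) (evalVar-∈ e w₂ w₂⊆M) (permVar-∈ e π π′⊆M C∈M) ⟩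
      swapAtom (atomOf ρ (evalVar e w₁)) (atomOf ρ (evalVar e w₂)) (atomOf ρ (permVar e π C))
        ≡⟨ cong₂ (λ a b → swapAtom a b (atomOf ρ (permVar e π C)))
                 (evalVar-sound w₁ w₁⊆M) (evalVar-sound w₂ w₂⊆M) ⟩
      swapAtom (⟦ ρ ⟧ᵃ w₁) (⟦ ρ ⟧ᵃ w₂) (atomOf ρ (permVar e π C))
        ≡⟨ cong (swapAtom (⟦ ρ ⟧ᵃ w₁) (⟦ ρ ⟧ᵃ w₂)) (permVar-sound π π′⊆M C∈M) ⟩
      swapAtom (⟦ ρ ⟧ᵃ w₁) (⟦ ρ ⟧ᵃ w₂) (permAtom ρ π (atomOf ρ C))
        ∎
      where open ≡-Reasoning

  unpermVar-sound : ∀ π {C} → All (_∈ M) (avP π) → C ∈ M →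
    atomOf ρ (unpermVar e π C) ≡ unpermAtom ρ π (atomOf ρ C)
  unpermVar-sound []              _    _   = refl
  unpermVar-sound ((w₁ , w₂) ∷ π) {C} π⊆M C∈M with All-avP-∷⁻ w₁ w₂ π π⊆M
  ... | w₁⊆M , w₂⊆M , π′⊆M = begin
    atomOf ρ (unpermVar e π (swapVar e (evalVar e w₁) (evalVar e w₂) C))
      ≡⟨ unpermVar-sound π π′⊆M (swapVar-∈ e W₁∈M W₂∈M C∈M) ⟩
    unpermAtom ρ π (atomOf ρ (swapVar e (evalVar e w₁) (evalVar e w₂) C))
      ≡⟨ cong (unpermAtom ρ π) (swapVar-sound W₁∈M W₂∈M C∈M) ⟩
    unpermAtom ρ π (swapAtom (atomOf ρ (evalVar e w₁)) (atomOf ρ (evalVar e w₂)) (atomOf ρ C))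
      ≡⟨ cong₂ (λ a b → unpermAtom ρ π (swapAtom a b (atomOf ρ C)))
               (evalVar-sound w₁ w₁⊆M) (evalVar-sound w₂ w₂⊆M) ⟩
    unpermAtom ρ π (swapAtom (⟦ ρ ⟧ᵃ w₁) (⟦ ρ ⟧ᵃ w₂) (atomOf ρ C))
      ∎
    where
    open ≡-Reasoning
    W₁∈M = evalVar-∈ e w₁ w₁⊆M
    W₂∈M = evalVar-∈ e w₂ w₂⊆M

Constraints : Set
Constraints = Maybe (List (AtomVar × TermVar))

infixr 6 _∧ᶜ_
_∧ᶜ_ : Constraints → Constraints → Constraints
_∧ᶜ_ = Maybe.zipWith _++_

CHolds-∧ᶜ : ∀ {F} (ρ : Interp F) c d → CHolds ρ (c ∧ᶜ d) ⇔ (CHolds ρ c × CHolds ρ d)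
CHolds-∧ᶜ ρ nothing   _         = mk⇔ (λ ()) (λ ())
CHolds-∧ᶜ ρ (just _)  nothing   = mk⇔ (λ ()) (λ ())
CHolds-∧ᶜ ρ (just cs) (just ds) = mk⇔ (Allₚ.++⁻ cs) (uncurry Allₚ.++⁺)

COver-∧ᶜ : ∀ {M} c d → COver M c → COver M d → COver M (c ∧ᶜ d)
COver-∧ᶜ nothing  _        _    _    = _
COver-∧ᶜ (just _) nothing  _    _    = _
COver-∧ᶜ (just _) (just _) c⊆M d⊆M = Allₚ.++⁺ c⊆M d⊆M

module _ {F : Set} (e : EqOracle) where
  mutual
    compileFresh : AtomVar → Term F → Constraints
    compileFresh A (atm w)    = if e A (evalVar e w) then nothing else just []
    compileFresh A (sus π X)  = just ((unpermVar e π A , X) ∷ [])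
    compileFresh A (fun f ss) = compileFreshAll A ss
    compileFresh A (lam w s)  = if e A (evalVar e w) then just [] else compileFresh A s

    compileFreshAll : AtomVar → List (Term F) → Constraints
    compileFreshAll A []       = just []
    compileFreshAll A (s ∷ ss) = compileFresh A s ∧ᶜ compileFreshAll A ss

  compileCtx : FreshCtx F → Constraints
  compileCtx []            = just []
  compileCtx ((w , s) ∷ ∇) = compileFresh (evalVar e w) s ∧ᶜ compileCtx ∇

  module _ {M : List AtomVar} where
    mutual
      compileFresh-over : ∀ {A} s → A ∈ M → All (_∈ M) (avT s) → COver M (compileFresh A s)
      compileFresh-over {A} (atm w) _ _ with e A (evalVar e w)
      ... | true  = _
      ... | false = []
      compileFresh-over (sus π X)  A∈M π⊆M  = unpermVar-∈ e π π⊆M A∈M ∷ []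
      compileFresh-over (fun f ss) A∈M ss⊆M = compileFreshAll-over ss A∈M ss⊆M
      compileFresh-over {A} (lam w s) A∈M ws⊆M with e A (evalVar e w)
      ... | true  = []
      ... | false = compileFresh-over s A∈M (Allₚ.++⁻ʳ (avA w) ws⊆M)

      compileFreshAll-over : ∀ {A} ss → A ∈ M → All (_∈ M) (avTs ss) →
        COver M (compileFreshAll A ss)
      compileFreshAll-over []       _   _ = []
      compileFreshAll-over {A} (s ∷ ss) A∈M sss⊆M with Allₚ.++⁻ (avT s) sss⊆M
      ... | s⊆M , ss⊆M = COver-∧ᶜ (compileFresh A s) (compileFreshAll A ss)
        (compileFresh-over s A∈M s⊆M) (compileFreshAll-over ss A∈M ss⊆M)

    compileCtx-over : ∀ ∇ → All (_∈ M) (atomVarsCtx ∇) → COver M (compileCtx ∇)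
    compileCtx-over []            _    = []
    compileCtx-over ((w , s) ∷ ∇) ∇⊆M with Allₚ.++⁻ (avA w) ∇⊆M
    ... | w⊆M , s∇⊆M with Allₚ.++⁻ (avT s) s∇⊆M
    ...   | s⊆M , ∇′⊆M = COver-∧ᶜ (compileFresh (evalVar e w) s) (compileCtx ∇)
      (compileFresh-over s (evalVar-∈ e w w⊆M) s⊆M) (compileCtx-over ∇ ∇′⊆M)

module _ {e : EqOracle} {F : Set} {ρ : Interp F} {M : List AtomVar} (dec : Decides ρ e M) where
  mutual
    compileFresh-sound : ∀ {A} s → A ∈ M → All (_∈ M) (avT s) →
      (¬ FreeIn (atomOf ρ A) (⟦ ρ ⟧ s)) ⇔ CHolds ρ (compileFresh e A s)
    compileFresh-sound {A} (atm w) A∈M w⊆M with e A (evalVar e w) | dec A∈M (evalVar-∈ e w w⊆M)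
    ... | true  | ofʸ A≈w = mk⇔ (λ fresh → fresh (from FreeIn-gat (trans A≈w w≈))) (λ ())
      where w≈ = evalVar-sound dec w w⊆M
    ... | false | ofⁿ A≉w = mk⇔ (λ _ → []) (λ _ free → A≉w (trans (to FreeIn-gat free) (sym w≈)))
      where w≈ = evalVar-sound dec w w⊆M
    compileFresh-sound {A} (sus π X) A∈M π⊆M =
      mk⇔ (λ fresh → to unpermuted fresh ∷ []) (λ { (fresh ∷ []) → from unpermuted fresh })
      where
      t = termOf ρ X
      unpermuted : (¬ FreeIn (atomOf ρ A) (permG ρ π t)) ⇔ (¬ FreeIn (atomOf ρ (unpermVar e π A)) t)
      unpermuted = subst (λ c → (¬ FreeIn (atomOf ρ A) (permG ρ π t)) ⇔ (¬ FreeIn c t))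
        (sym (unpermVar-sound dec π π⊆M A∈M)) (¬-cong-⇔ (FreeIn-permG ρ π t))
    compileFresh-sound (fun f ss) A∈M ss⊆M = compileFreshAll-sound ss A∈M ss⊆M ⇔-∘ fresh-gfun
    compileFresh-sound {A} (lam w s) A∈M ws⊆M
      with e A (evalVar e w) | dec A∈M (evalVar-∈ e w (Allₚ.++⁻ˡ (avA w) ws⊆M))
    ... | true  | ofʸ A≈w = mk⇔ (λ _ → []) (λ { _ (free-lam A≢w _) → A≢w (trans A≈w w≈) })
      where w≈ = evalVar-sound dec w (Allₚ.++⁻ˡ (avA w) ws⊆M)
    ... | false | ofⁿ A≉w =
      compileFresh-sound s A∈M (Allₚ.++⁻ʳ (avA w) ws⊆M)
        ⇔-∘ ¬-cong-⇔ (FreeIn-glam (λ A≡w → A≉w (trans A≡w (sym w≈))))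
      where w≈ = evalVar-sound dec w (Allₚ.++⁻ˡ (avA w) ws⊆M)

    compileFreshAll-sound : ∀ {A} ss → A ∈ M → All (_∈ M) (avTs ss) →
      All (λ t → ¬ FreeIn (atomOf ρ A) t) (⟦ ρ ⟧s ss) ⇔ CHolds ρ (compileFreshAll e A ss)
    compileFreshAll-sound []       _   _ = mk⇔ (λ _ → []) (λ _ → [])
    compileFreshAll-sound {A} (s ∷ ss) A∈M sss⊆M with Allₚ.++⁻ (avT s) sss⊆M
    ... | s⊆M , ss⊆M =
      ⇔-sym (CHolds-∧ᶜ ρ (compileFresh e A s) (compileFreshAll e A ss))
        ⇔-∘ ((compileFresh-sound s A∈M s⊆M ×-⇔ compileFreshAll-sound ss A∈M ss⊆M)
        ⇔-∘ All-∷⇔)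

  compileCtx-sound : ∀ ∇ → All (_∈ M) (atomVarsCtx ∇) → HoldsCtx ρ ∇ ⇔ CHolds ρ (compileCtx e ∇)
  compileCtx-sound []            _    = mk⇔ (λ _ → []) (λ _ → [])
  compileCtx-sound ((w , s) ∷ ∇) ∇⊆M with Allₚ.++⁻ (avA w) ∇⊆M
  ... | w⊆M , s∇⊆M with Allₚ.++⁻ (avT s) s∇⊆M
  ...   | s⊆M , ∇′⊆M =
    ⇔-sym (CHolds-∧ᶜ ρ (compileFresh e (evalVar e w) s) (compileCtx e ∇))
      ⇔-∘ ((head-sound ×-⇔ compileCtx-sound ∇ ∇′⊆M) ⇔-∘ All-∷⇔)
    where
    head-sound : (¬ FreeIn (⟦ ρ ⟧ᵃ w) (⟦ ρ ⟧ s)) ⇔ CHolds ρ (compileFresh e (evalVar e w) s)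
    head-sound = subst (λ a → (¬ FreeIn a (⟦ ρ ⟧ s)) ⇔ CHolds ρ (compileFresh e (evalVar e w) s))
      (evalVar-sound dec w w⊆M) (compileFresh-sound s (evalVar-∈ e w w⊆M) s⊆M)

litKey : EqLit → AtomVar × AtomVar
litKey (A ≐ B) = A , B
litKey (A ≭ B) = A , B

polarity : EqLit → Bool
polarity (_ ≐ _) = true
polarity (_ ≭ _) = false

-- Pairs not listed in S answer false; decideBy-decides only queries pairs of M × M, all listed.
decideBy : List EqLit → EqOracle
decideBy []      A B = false
decideBy (l ∷ S) A B with ≡-dec _≟_ _≟_ (litKey l) (A , B)
... | yes _ = polarity l
... | no _  = decideBy S A B

module _ {F : Set} (ρ : Interp F) where
  LitHolds-reflects : ∀ l → LitHolds ρ l →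
    Reflects (atomOf ρ (proj₁ (litKey l)) ≡ atomOf ρ (proj₂ (litKey l))) (polarity l)
  LitHolds-reflects (_ ≐ _) A≈B = ofʸ A≈B
  LitHolds-reflects (_ ≭ _) A≉B = ofⁿ A≉B

  decideBy-reflects : ∀ {S A B} → All (LitHolds ρ) S → (A , B) ∈ map litKey S →
    Reflects (atomOf ρ A ≡ atomOf ρ B) (decideBy S A B)
  decideBy-reflects {l ∷ S} {A} {B} (l-holds ∷ S-holds) AB∈S with ≡-dec _≟_ _≟_ (litKey l) (A , B)
  ... | yes refl = LitHolds-reflects l l-holds
  ... | no l≢AB  = decideBy-reflects S-holds (Any.tail (l≢AB ∘ sym) AB∈S)

decideBy-decides : ∀ {F} {ρ : Interp F} {M S} → map litKey S ≡ cartesianProduct M M →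
  All (LitHolds ρ) S → Decides ρ (decideBy S) M
decideBy-decides {ρ = ρ} keys S-holds A∈M B∈M =
  decideBy-reflects ρ S-holds (subst (_ ∈_) (sym keys) (∈-cartesianProduct⁺ A∈M B∈M))

LitOver-litKey : ∀ {M} l → proj₁ (litKey l) ∈ M × proj₂ (litKey l) ∈ M → LitOver M l
LitOver-litKey (_ ≐ _) = id
LitOver-litKey (_ ≭ _) = id

litKeys-over : ∀ {M S} → map litKey S ≡ cartesianProduct M M → All (LitOver M) S
litKeys-over {M} keys = All.tabulate λ {l} l∈S →
  LitOver-litKey l (∈-cartesianProduct⁻ M M (subst (litKey l ∈_) keys (∈-map⁺ litKey l∈S)))

eqCases : List (AtomVar × AtomVar) → List (List EqLit)
eqCases []             = [] ∷ []
eqCases ((A , B) ∷ ps) = map ((A ≐ B) ∷_) (eqCases ps) ++ map ((A ≭ B) ∷_) (eqCases ps)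

eqCases-keys : ∀ ps → All (λ S → map litKey S ≡ ps) (eqCases ps)
eqCases-keys []             = refl ∷ []
eqCases-keys ((A , B) ∷ ps) = Allₚ.++⁺ (Allₚ.map⁺ keys) (Allₚ.map⁺ keys)
  where keys = All.map (cong ((A , B) ∷_)) (eqCases-keys ps)

eqCases-cover : ∀ {F} (ρ : Interp F) ps →
  Any (λ S → map litKey S ≡ ps × All (LitHolds ρ) S) (eqCases ps)
eqCases-cover ρ []             = here (refl , [])
eqCases-cover ρ ((A , B) ∷ ps) with atomOf ρ A ≟ atomOf ρ B
... | yes A≈B = Anyₚ.++⁺ˡ (Anyₚ.map⁺ (Any.map (λ (keys , holds) →
                  cong ((A , B) ∷_) keys , A≈B ∷ holds) (eqCases-cover ρ ps)))
... | no  A≉B = Anyₚ.++⁺ʳ _ (Anyₚ.map⁺ (Any.map (λ (keys , holds) →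
                  cong ((A , B) ∷_) keys , A≉B ∷ holds) (eqCases-cover ρ ps)))

toEQR : ∀ {F} → FreshCtx F → EQRCtx
toEQR ∇ = map (λ S → S , compileCtx (decideBy S) ∇) (eqCases (cartesianProduct M M))
  where M = atomVarsCtx ∇

toEQR-over : ∀ {F} (∇ : FreshCtx F) → EQROver (atomVarsCtx ∇) (toEQR ∇)
toEQR-over ∇ = Allₚ.map⁺ (All.map
  (λ keys → litKeys-over keys , compileCtx-over _ ∇ (All.tabulate id)) (eqCases-keys _))

mainTheorem6 : (F : Set) (∇ : FreshCtx F) →
    ∃[ 𝒞 ] (EQROver (atomVarsCtx ∇) 𝒞 × ((ρ : Interp F) → HoldsCtx ρ ∇ ⇔ SatEQR ρ 𝒞))
mainTheorem6 F ∇ = toEQR ∇ , toEQR-over ∇ , λ ρ → mk⇔ (holds⇒sat ρ) (sat⇒holds ρ)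
  where
  M = atomVarsCtx ∇
  ps = cartesianProduct M M

  compile-sound : ∀ ρ {S} → map litKey S ≡ ps → All (LitHolds ρ) S →
    HoldsCtx ρ ∇ ⇔ CHolds ρ (compileCtx (decideBy S) ∇)
  compile-sound ρ keys S-holds =
    compileCtx-sound (decideBy-decides keys S-holds) ∇ (All.tabulate id)

  holds⇒sat : ∀ ρ → HoldsCtx ρ ∇ → SatEQR ρ (toEQR ∇)
  holds⇒sat ρ ∇-holds = Anyₚ.map⁺ (Any.map (λ (keys , S-holds) →
    S-holds , to (compile-sound ρ keys S-holds) ∇-holds) (eqCases-cover ρ ps))

  sat⇒holds : ∀ ρ → SatEQR ρ (toEQR ∇) → HoldsCtx ρ ∇
  sat⇒holds ρ sat with All.lookupAny (eqCases-keys ps) (Anyₚ.map⁻ sat)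
  ... | keys , S-holds , compiled-holds = from (compile-sound ρ keys S-holds) compiled-holds
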